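{- Let $n \geq 5$ be an integer. Then: (1) For every integer $j$ with $0 \le j \le F_{n-3}-2$, we have $a(F_n + j) = (-1)^{n-1}\, a(F_{n-3}-2-j)$; that is, the numbers $a(F_n), a(F_n+1), \ldots, a(F_n+F_{n-3}-2)$ are equal to $(-1)^{n-1}a(F_{n-3}-2), (-1)^{n-1}a(F_{n-3}-3), \ldots, (-1)^{n-1}a(0)$ in that order. (2) For every integer $m$ with $F_n+F_{n-3}-1 \le m \le F_n+F_{n-2}-1$, we have $a(m)=0$. (3) For every integer $j$ with $0 \le j \le F_{n-3}-1$, we have $a(F_n+F_{n-2}+j) = a(j)$; that is, the numbers $a(F_n+F_{n-2}), a(F_n+F_{n-2}+1), \ldots, a(F_{n+1}-1)$ are equal to $a(0), a(1), \ldots, a(F_{n-3}-1)$ in that order.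
   Context: The Fibonacci numbers are defined by $F_0=0$, $F_1=1$, and $F_{n+2}=F_{n+1}+F_n$ for $n\ge 0$. Let $A(x) = \prod_{k\ge 2}(1-x^{F_k}) = (1-x)(1-x^2)(1-x^3)(1-x^5)(1-x^8)\cdots$, regarded as a formal power series with integer coefficients, and for each integer $m \ge 0$ let $a(m)$ denote the coefficient of $x^m$ in $A(x)$. Equivalently, $a(m)$ is the number of partitions of $m$ into an even number of distinct positive Fibonacci numbers minus the number of partitions of $m$ into an odd number of distinct positive Fibonacci numbers (here the distinct positive Fibonacci numbers are $F_2=1, F_3=2, F_4=3, F_5=5,\ldots$). -}

module Defs where

open import Data.Nat using (ℕ; zero; suc; _+_; _∸_; _≤?_)
open import Data.Integer using (ℤ; 0ℤ; 1ℤ; _-_)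
open import Relation.Nullary using (yes; no)

F : ℕ → ℕ
F zero = 0
F (suc zero) = 1
F (suc (suc n)) = F (suc n) + F n

-- Power series viewed as coefficient functions ℕ → ℤ.
-- Multiplication of a series by (1 - x^d):  coefficient m of the result is
-- c m - c (m - d)  (the second term present only when d ≤ m).
mul1-xpow : ℕ → (ℕ → ℤ) → (ℕ → ℤ)
mul1-xpow d c m with d ≤? m
... | yes _ = c m - c (m ∸ d)
... | no  _ = c m

-- partialProd N = coefficient function of ∏_{k=2}^{N} (1 - x^{F k})
-- (the empty product 1 for N ≤ 1).
one : ℕ → ℤ
one zero = 1ℤ
one (suc _) = 0ℤ

partialProd : ℕ → (ℕ → ℤ)
partialProd zero = one
partialProd (suc zero) = one
partialProd (suc (suc N)) = mul1-xpow (F (suc (suc N))) (partialProd (suc N))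

-- a m = coefficient of x^m in A(x) = ∏_{k≥2} (1 - x^{F k}).
-- Factors with F k > m do not affect the coefficient of x^m, and
-- F (m + 2) > m, so the partial product up to k = m + 2 suffices.
a : ℕ → ℤ
a m = partialProd (m + 2) m

sgn : ℕ → ℤ
sgn zero = 1ℤ
sgn (suc n) = Data.Integer.- sgn n

{-# OPTIONS --safe #-}
-- Let P_K = (1 - x^F 2) ⋯ (1 - x^F K). As F 2 + ⋯ + F K = F (K + 2) - 2, the polynomial x · P_K is
-- palindromic up to the sign (-1)^(K-1): its coefficients at i and at F (K + 2) - i agree up to
-- that sign. Since A ≡ P_K modulo x^F (K + 1), this gives, for j + l = F (n - 1), that the
-- coefficient of x^(F n + j) in x · A is (-1)^n times the coefficient at l minus the one at j.
-- Two applications of this recurrence (at n and at n - 2) give parts (1) and (3); one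
-- application together with the palindromy of x · P_(n-3) gives part (2).
module Submission where

open import Defs
open import Data.Nat using (ℕ; _+_; _∸_; _≤_)
open import Data.Integer using (ℤ; _*_; 0ℤ)
open import Data.Product using (_×_)
open import Relation.Binary.PropositionalEquality using (_≡_)

open import Data.Nat using (zero; suc; z≤n; s≤s; _<_; _≤′_; ≤′-refl; ≤′-step; _≤?_)
import Data.Nat.Properties as ℕₚ
open import Data.Integer as ℤ using (+_; -[1+_]; _-_; -_; 1ℤ)
import Data.Integer.Properties as ℤₚ
import Algebra.Properties.CommutativeSemigroup ℕₚ.+-commutativeSemigroup as +-CS
open import Data.Integer.Tactic.RingSolver using (solve-∀)
import Data.Nat.Tactic.RingSolver as ℕ-Solver
open import Data.Product using (_,_)
open import Data.Sum using (inj₁; inj₂)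
open import Relation.Binary.PropositionalEquality using (refl; sym; trans; cong; cong₂; module ≡-Reasoning)
open import Relation.Nullary using (yes; no)

open ≡-Reasoning

F-mono-≤ : ∀ {m n} → m ≤ n → F m ≤ F n
F-mono-≤ m≤n = F-mono-≤′ (ℕₚ.≤⇒≤′ m≤n)
  where
  F[n]≤F[1+n] : ∀ n → F n ≤ F (suc n)
  F[n]≤F[1+n] zero = z≤n
  F[n]≤F[1+n] (suc n) = ℕₚ.m≤m+n (F (suc n)) (F n)

  F-mono-≤′ : ∀ {m n} → m ≤′ n → F m ≤ F n
  F-mono-≤′ ≤′-refl = ℕₚ.≤-refl
  F-mono-≤′ {n = suc n} (≤′-step m≤′n) = ℕₚ.≤-trans (F-mono-≤′ m≤′n) (F[n]≤F[1+n] n)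

F[1+n]>0 : ∀ n → 0 < F (suc n)
F[1+n]>0 zero = s≤s z≤n
F[1+n]>0 (suc n) = ℕₚ.<-≤-trans (F[1+n]>0 n) (ℕₚ.m≤m+n _ _)

n≤F[1+n] : ∀ n → n ≤ F (suc n)
n≤F[1+n] zero = z≤n
n≤F[1+n] (suc zero) = s≤s z≤n
n≤F[1+n] (suc (suc n)) =
  ℕₚ.≤-trans (ℕₚ.≤-reflexive (ℕₚ.+-comm 1 (suc n))) (ℕₚ.+-mono-≤ (n≤F[1+n] (suc n)) (F[1+n]>0 n))

sgn[2+n]≡sgn[n] : ∀ n → sgn (2 + n) ≡ sgn n
sgn[2+n]≡sgn[n] n = ℤₚ.neg-involutive (sgn n)

sgn[n]*sgn[n]≡1 : ∀ n → sgn n * sgn n ≡ 1ℤ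
sgn[n]*sgn[n]≡1 zero = refl
sgn[n]*sgn[n]≡1 (suc n) = trans (neg*neg (sgn n)) (sgn[n]*sgn[n]≡1 n)
  where
  neg*neg : ∀ s → (- s) * (- s) ≡ s * s
  neg*neg = solve-∀

s*[s*x-y]-x≡-[s*y] : ∀ s x y → s * s ≡ 1ℤ → s * (s * x - y) - x ≡ - (s * y)
s*[s*x-y]-x≡-[s*y] s x y s*s≡1 = begin
    s * (s * x - y) - x     ≡⟨ expand s x y ⟩
    (s * s) * x - x - s * y ≡⟨ cong (λ t → t * x - x - s * y) s*s≡1 ⟩
    1ℤ * x - x - s * y      ≡⟨ collapse x (s * y) ⟩
    - (s * y)               ∎
  where
  expand : ∀ s x y → s * (s * x - y) - x ≡ (s * s) * x - x - s * y
  expand = solve-∀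
  collapse : ∀ x z → 1ℤ * x - x - z ≡ - z
  collapse = solve-∀

i+j≡k⇒j≡k-i : ∀ i j {k} → i ℤ.+ j ≡ k → j ≡ k - i
i+j≡k⇒j≡k-i i j refl = cancel i j
  where
  cancel : ∀ i j → j ≡ i ℤ.+ j - i
  cancel = solve-∀

i+j≡k+n⇒i+[j-n]≡k : ∀ i j k n → i ℤ.+ j ≡ k ℤ.+ n → i ℤ.+ (j - n) ≡ k
i+j≡k+n⇒i+[j-n]≡k i j k n i+j≡k+n = begin
    i ℤ.+ (j - n)  ≡⟨ regroup i j n ⟩
    i ℤ.+ j - n    ≡⟨ cong (_- n) i+j≡k+n ⟩
    k ℤ.+ n - n    ≡⟨ cancel k n ⟩
    k              ∎
  where
  regroup : ∀ i j n → i ℤ.+ (j - n) ≡ i ℤ.+ j - n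
  regroup = solve-∀
  cancel : ∀ k n → k ℤ.+ n - n ≡ k
  cancel = solve-∀

δ₁ : ℤ → ℤ
δ₁ (+ 1) = 1ℤ
δ₁ _ = 0ℤ

δ₁-nonpos : ∀ {i} → i ℤ.≤ 0ℤ → δ₁ i ≡ 0ℤ
δ₁-nonpos {+ zero} _ = refl
δ₁-nonpos { -[1+ _ ]} _ = refl
δ₁-nonpos {+ suc _} (ℤ.+≤+ ())

δ₁[2-i]≡δ₁[i] : ∀ i → δ₁ (+ 2 - i) ≡ δ₁ i
δ₁[2-i]≡δ₁[i] (+ zero) = refl
δ₁[2-i]≡δ₁[i] (+ suc zero) = refl
δ₁[2-i]≡δ₁[i] (+ suc (suc zero)) = refl
δ₁[2-i]≡δ₁[i] (+ suc (suc (suc _))) = refl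
δ₁[2-i]≡δ₁[i] -[1+ _ ] = refl

-- xP K i is the coefficient of x^i in x · P_K, for every integer i, and xA m that of x^m in x · A.
-- The factor x makes the symmetry read i + j = F (K + 2); with integer indices the coefficients at
-- i ≤ 0 are simply zero, so the recursion needs no truncated subtraction.
xP : ℕ → ℤ → ℤ
xP zero = δ₁
xP (suc zero) = δ₁
xP (suc (suc K)) i = xP (suc K) i - xP (suc K) (i - + F (suc (suc K)))

xA : ℕ → ℤ
xA zero = 0ℤ
xA (suc m) = a m

xP-nonpos : ∀ K {i} → i ℤ.≤ 0ℤ → xP K i ≡ 0ℤ
xP-nonpos zero i≤0 = δ₁-nonpos i≤0
xP-nonpos (suc zero) i≤0 = δ₁-nonpos i≤0
xP-nonpos (suc (suc K)) {i} i≤0 =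
  cong₂ _-_ (xP-nonpos (suc K) i≤0) (xP-nonpos (suc K) (ℤₚ.≤-trans (ℤₚ.i-j≤i i _) i≤0))

shift-mul1-xpow : ∀ d (c : ℕ → ℤ) (q : ℤ → ℤ) → (∀ {i} → i ℤ.≤ 0ℤ → q i ≡ 0ℤ) →
                  (∀ m → q (+ suc m) ≡ c m) → ∀ m → q (+ suc m) - q (+ suc m - + d) ≡ mul1-xpow d c m
shift-mul1-xpow d c q q-nonpos q≡c m with d ≤? m
... | yes d≤m = cong₂ _-_ (q≡c m) (trans (cong q shifted) (q≡c (m ∸ d)))
  where
  shifted : + suc m - + d ≡ + suc (m ∸ d)
  shifted = trans (ℤₚ.[+m]-[+n]≡m⊖n (suc m) d)
                  (trans (ℤₚ.⊖-≥ (ℕₚ.m≤n⇒m≤1+n d≤m)) (cong +_ (ℕₚ.+-∸-assoc 1 d≤m)))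
... | no d≰m = trans (cong₂ _-_ (q≡c m) (q-nonpos (ℤₚ.i≤j⇒i-j≤0 (ℤ.+≤+ (ℕₚ.≰⇒> d≰m))))) (ℤₚ.+-identityʳ (c m))

xP-partialProd : ∀ K m → xP K (+ suc m) ≡ partialProd K m
xP-partialProd zero zero = refl
xP-partialProd zero (suc m) = refl
xP-partialProd (suc zero) zero = refl
xP-partialProd (suc zero) (suc m) = refl
xP-partialProd (suc (suc K)) =
  shift-mul1-xpow (F (suc (suc K))) (partialProd (suc K)) (xP (suc K)) (xP-nonpos (suc K)) (xP-partialProd (suc K))

xP-palindromic : ∀ K {i j} → i ℤ.+ j ≡ + F (3 + K) → xP (suc K) i ≡ sgn K * xP (suc K) j
xP-palindromic zero {i} {j} i+j≡2 = begin
    δ₁ i              ≡⟨ δ₁[2-i]≡δ₁[i] i ⟨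
    δ₁ (+ 2 - i)      ≡⟨ cong δ₁ (i+j≡k⇒j≡k-i i j i+j≡2) ⟨
    δ₁ j              ≡⟨ ℤₚ.*-identityˡ (δ₁ j) ⟨
    1ℤ * δ₁ j         ∎
xP-palindromic (suc K) {i} {j} i+j≡F = begin
    P i - P (i - f)          ≡⟨ cong₂ _-_ (xP-palindromic K i+[j-f]≡F) (xP-palindromic K [i-f]+j≡F) ⟩
    s * P (j - f) - s * P j  ≡⟨ flip s (P (j - f)) (P j) ⟩
    (- s) * (P j - P (j - f)) ∎
  where
  P = xP (suc K)
  s = sgn K
  f = + F (2 + K)
  i+j≡F[3+K]+f : i ℤ.+ j ≡ + F (3 + K) ℤ.+ f
  i+j≡F[3+K]+f = trans i+j≡F (ℤₚ.pos-+ (F (3 + K)) (F (2 + K)))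
  i+[j-f]≡F : i ℤ.+ (j - f) ≡ + F (3 + K)
  i+[j-f]≡F = i+j≡k+n⇒i+[j-n]≡k i j _ f i+j≡F[3+K]+f
  [i-f]+j≡F : (i - f) ℤ.+ j ≡ + F (3 + K)
  [i-f]+j≡F = trans (ℤₚ.+-comm (i - f) j) (i+j≡k+n⇒i+[j-n]≡k j i _ f (trans (ℤₚ.+-comm j i) i+j≡F[3+K]+f))
  flip : ∀ s x y → s * x - s * y ≡ (- s) * (y - x)
  flip = solve-∀

xP-suc : ∀ K {i} → i ℤ.≤ + F (suc K) → xP (suc K) i ≡ xP K i
xP-suc zero _ = refl
xP-suc (suc K) {i} i≤F =
  trans (cong (λ z → xP (suc K) i - z) (xP-nonpos (suc K) (ℤₚ.i≤j⇒i-j≤0 i≤F))) (ℤₚ.+-identityʳ (xP (suc K) i))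

xP-stable : ∀ {K M i} → K ≤ M → i ℤ.≤ + F (suc K) → xP M i ≡ xP K i
xP-stable {K} {M} {i} K≤M i≤F = xP-stable′ (ℕₚ.≤⇒≤′ K≤M)
  where
  xP-stable′ : ∀ {M} → K ≤′ M → xP M i ≡ xP K i
  xP-stable′ ≤′-refl = refl
  xP-stable′ {suc M} (≤′-step K≤′M) =
    trans (xP-suc M (ℤₚ.≤-trans i≤F (ℤ.+≤+ (F-mono-≤ (s≤s (ℕₚ.≤′⇒≤ K≤′M)))))) (xP-stable′ K≤′M)

xP-agree : ∀ K M {i} → i ℤ.≤ + F (suc K) → i ℤ.≤ + F (suc M) → xP K i ≡ xP M i
xP-agree K M i≤F[1+K] i≤F[1+M] with ℕₚ.≤-total K M
... | inj₁ K≤M = sym (xP-stable K≤M i≤F[1+K])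
... | inj₂ M≤K = xP-stable M≤K i≤F[1+M]

xA≡xP : ∀ K {i} → i ≤ F (suc K) → xA i ≡ xP K (+ i)
xA≡xP K {zero} _ = sym (xP-nonpos K ℤₚ.≤-refl)
xA≡xP K {suc m} i≤F = begin
    partialProd (m + 2) m   ≡⟨ xP-partialProd (m + 2) m ⟨
    xP (m + 2) (+ suc m)    ≡⟨ xP-agree (m + 2) K (ℤ.+≤+ 1+m≤F) (ℤ.+≤+ i≤F) ⟩
    xP K (+ suc m)          ∎
  where
  1+m≤F : suc m ≤ F (suc (m + 2))
  1+m≤F = ℕₚ.≤-trans (ℕₚ.m<m+n m (s≤s z≤n)) (n≤F[1+n] (m + 2))

xA-recurrence : ∀ N {j l} → j + l ≡ F (suc N) → xA (F (2 + N) + j) ≡ sgn N * xA l - xA j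
xA-recurrence N {j} {l} j+l≡F = begin
    xA (f + j)                           ≡⟨ xA≡xP (2 + N) (ℕₚ.+-monoʳ-≤ f j≤F[1+N]) ⟩
    P (+ (f + j)) - P (+ (f + j) - + f)  ≡⟨ cong₂ _-_ (xP-palindromic N palindrome) (cong P (sym shift)) ⟩
    sgn N * P (+ l) - P (+ j)            ≡⟨ cong₂ (λ x y → sgn N * x - y) (sym (xA≡xP (suc N) l≤F)) (sym (xA≡xP (suc N) j≤F)) ⟩
    sgn N * xA l - xA j                  ∎
  where
  f = F (2 + N)
  P = xP (suc N)
  j≤F[1+N] : j ≤ F (suc N)
  j≤F[1+N] = ℕₚ.≤-trans (ℕₚ.m≤m+n j l) (ℕₚ.≤-reflexive j+l≡F)
  j≤F : j ≤ F (2 + N)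
  j≤F = ℕₚ.≤-trans j≤F[1+N] (F-mono-≤ (ℕₚ.n≤1+n (suc N)))
  l≤F : l ≤ F (2 + N)
  l≤F = ℕₚ.≤-trans (ℕₚ.≤-trans (ℕₚ.m≤n+m l j) (ℕₚ.≤-reflexive j+l≡F)) (F-mono-≤ (ℕₚ.n≤1+n (suc N)))
  shift : + j ≡ + (f + j) - + f
  shift = i+j≡k⇒j≡k-i (+ f) (+ j) (sym (ℤₚ.pos-+ f j))
  palindrome : + (f + j) ℤ.+ + l ≡ + F (3 + N)
  palindrome = trans (sym (ℤₚ.pos-+ (f + j) l)) (cong +_ (trans (ℕₚ.+-assoc f j l) (cong (λ x → f + x) j+l≡F)))

xA-palindromic : ∀ K {i l} → i + l ≡ F (3 + K) → i ≤ F (2 + K) → l ≤ F (2 + K) → xA i ≡ sgn K * xA l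
xA-palindromic K {i} {l} i+l≡F i≤F l≤F = begin
    xA i                      ≡⟨ xA≡xP (suc K) i≤F ⟩
    xP (suc K) (+ i)          ≡⟨ xP-palindromic K (trans (sym (ℤₚ.pos-+ i l)) (cong +_ i+l≡F)) ⟩
    sgn K * xP (suc K) (+ l)  ≡⟨ cong (sgn K *_) (xA≡xP (suc K) l≤F) ⟨
    sgn K * xA l              ∎

xA-reflect : ∀ k {j i} → j + i ≡ F (1 + k) → xA (F (4 + k) + j) ≡ sgn (3 + k) * xA i
xA-reflect k {j} {i} j+i≡F = begin
    xA (F (4 + k) + j)                ≡⟨ xA-recurrence (2 + k) j+[F[2+k]+i]≡F ⟩
    s * xA (F (2 + k) + i) - xA j     ≡⟨ cong (λ y → s * y - xA j) (xA-recurrence k (trans (ℕₚ.+-comm i j) j+i≡F)) ⟩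
    s * (sgn k * xA j - xA i) - xA j  ≡⟨ cong (λ t → s * (t * xA j - xA i) - xA j) (sgn[2+n]≡sgn[n] k) ⟨
    s * (s * xA j - xA i) - xA j      ≡⟨ s*[s*x-y]-x≡-[s*y] s (xA j) (xA i) (sgn[n]*sgn[n]≡1 (2 + k)) ⟩
    - (s * xA i)                      ≡⟨ ℤₚ.neg-distribˡ-* s (xA i) ⟩
    sgn (3 + k) * xA i                ∎
  where
  s = sgn (2 + k)
  j+[F[2+k]+i]≡F : j + (F (2 + k) + i) ≡ F (3 + k)
  j+[F[2+k]+i]≡F = trans (+-CS.x∙yz≈y∙xz j (F (2 + k)) i) (cong (λ x → F (2 + k) + x) j+i≡F)

xA-vanish : ∀ k {j l} → j + l ≡ F (3 + k) → j ≤ F (2 + k) → l ≤ F (2 + k) → xA (F (4 + k) + j) ≡ 0ℤ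
xA-vanish k {j} {l} j+l≡F j≤F l≤F = begin
    xA (F (4 + k) + j)                 ≡⟨ xA-recurrence (2 + k) j+l≡F ⟩
    sgn (2 + k) * xA l - xA j          ≡⟨ cong₂ (λ t y → t * xA l - y) (sgn[2+n]≡sgn[n] k) (xA-palindromic k j+l≡F j≤F l≤F) ⟩
    sgn k * xA l - sgn k * xA l        ≡⟨ ℤₚ.+-inverseʳ (sgn k * xA l) ⟩
    0ℤ                                 ∎

xA-repeat : ∀ k {j i} → j + i ≡ F (1 + k) → xA (F (4 + k) + (F (2 + k) + j)) ≡ xA j
xA-repeat k {j} {i} j+i≡F = begin
    xA (F (4 + k) + (F (2 + k) + j))    ≡⟨ xA-recurrence (2 + k) [F[2+k]+j]+i≡F ⟩
    s * xA i - xA (F (2 + k) + j)       ≡⟨ cong (λ y → s * xA i - y) (xA-recurrence k j+i≡F) ⟩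
    s * xA i - (sgn k * xA i - xA j)    ≡⟨ cong (λ t → s * xA i - (t * xA i - xA j)) (sgn[2+n]≡sgn[n] k) ⟨
    s * xA i - (s * xA i - xA j)        ≡⟨ x-[x-y]≡y (s * xA i) (xA j) ⟩
    xA j                                ∎
  where
  s = sgn (2 + k)
  [F[2+k]+j]+i≡F : F (2 + k) + j + i ≡ F (3 + k)
  [F[2+k]+j]+i≡F = trans (ℕₚ.+-assoc (F (2 + k)) j i) (cong (λ x → F (2 + k) + x) j+i≡F)
  x-[x-y]≡y : ∀ x y → x - (x - y) ≡ y
  x-[x-y]≡y = solve-∀

a-reflect : ∀ k (j : ℕ) → j + 2 ≤ F (1 + k) → a (F (4 + k) + j) ≡ sgn (3 + k) * a (F (1 + k) ∸ 2 ∸ j)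
a-reflect k j j+2≤F = begin
    a (F (4 + k) + j)                    ≡⟨ cong xA (ℕₚ.+-suc (F (4 + k)) j) ⟨
    xA (F (4 + k) + suc j)               ≡⟨ xA-reflect k [1+j]+[1+r]≡F ⟩
    sgn (3 + k) * a (F (1 + k) ∸ 2 ∸ j)  ∎
  where
  [1+j]+[1+r]≡F : suc j + suc (F (1 + k) ∸ 2 ∸ j) ≡ F (1 + k)
  [1+j]+[1+r]≡F = begin
    suc j + suc (F (1 + k) ∸ 2 ∸ j)  ≡⟨ ℕₚ.+-suc (suc j) _ ⟩
    2 + j + (F (1 + k) ∸ 2 ∸ j)      ≡⟨ cong (λ x → 2 + j + x) (ℕₚ.∸-+-assoc (F (1 + k)) 2 j) ⟩
    2 + j + (F (1 + k) ∸ (2 + j))    ≡⟨ ℕₚ.m+[n∸m]≡n (ℕₚ.≤-trans (ℕₚ.≤-reflexive (ℕₚ.+-comm 2 j)) j+2≤F) ⟩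
    F (1 + k)                        ∎

a-vanish : ∀ k (m : ℕ) → F (4 + k) + F (1 + k) ≤ m + 1 → m + 1 ≤ F (4 + k) + F (2 + k) → a m ≡ 0ℤ
a-vanish k m lower upper = begin
    a m                 ≡⟨ cong xA (trans (ℕₚ.+-comm 1 m) (sym F[4+k]+j≡m+1)) ⟩
    xA (F (4 + k) + j)  ≡⟨ xA-vanish k j+l≡F j≤F l≤F ⟩
    0ℤ                  ∎
  where
  j = m + 1 ∸ F (4 + k)
  l = F (3 + k) ∸ j
  F[4+k]+j≡m+1 : F (4 + k) + j ≡ m + 1
  F[4+k]+j≡m+1 = ℕₚ.m+[n∸m]≡n (ℕₚ.≤-trans (ℕₚ.m≤m+n (F (4 + k)) (F (1 + k))) lower)
  F≤j : F (1 + k) ≤ j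
  F≤j = ℕₚ.+-cancelˡ-≤ (F (4 + k)) _ _ (ℕₚ.≤-trans lower (ℕₚ.≤-reflexive (sym F[4+k]+j≡m+1)))
  j≤F : j ≤ F (2 + k)
  j≤F = ℕₚ.+-cancelˡ-≤ (F (4 + k)) _ _ (ℕₚ.≤-trans (ℕₚ.≤-reflexive F[4+k]+j≡m+1) upper)
  j+l≡F : j + l ≡ F (3 + k)
  j+l≡F = ℕₚ.m+[n∸m]≡n (ℕₚ.≤-trans j≤F (ℕₚ.m≤m+n _ _))
  l≤F : l ≤ F (2 + k)
  l≤F = ℕₚ.≤-trans (ℕₚ.∸-monoʳ-≤ (F (3 + k)) F≤j) (ℕₚ.≤-reflexive (ℕₚ.m+n∸n≡m (F (2 + k)) (F (1 + k))))

a-repeat : ∀ k (j : ℕ) → j + 1 ≤ F (1 + k) → a (F (4 + k) + F (2 + k) + j) ≡ a j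
a-repeat k j j+1≤F = begin
    a (F (4 + k) + F (2 + k) + j)       ≡⟨ cong xA (regroup (F (4 + k)) (F (2 + k)) j) ⟩
    xA (F (4 + k) + (F (2 + k) + suc j)) ≡⟨ xA-repeat k (ℕₚ.m+[n∸m]≡n 1+j≤F) ⟩
    a j                                 ∎
  where
  1+j≤F : suc j ≤ F (1 + k)
  1+j≤F = ℕₚ.≤-trans (ℕₚ.≤-reflexive (ℕₚ.+-comm 1 j)) j+1≤F
  regroup : ∀ x y z → suc (x + y + z) ≡ x + (y + suc z)
  regroup = ℕ-Solver.solve-∀

proposition1 : (n : ℕ) → 5 ≤ n →
    ((j : ℕ) → j + 2 ≤ F (n ∸ 3) →
        a (F n + j) ≡ sgn (n ∸ 1) * a (F (n ∸ 3) ∸ 2 ∸ j))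
    × ((m : ℕ) → F n + F (n ∸ 3) ≤ m + 1 → m + 1 ≤ F n + F (n ∸ 2) →
        a m ≡ 0ℤ)
    × ((j : ℕ) → j + 1 ≤ F (n ∸ 3) →
        a (F n + F (n ∸ 2) + j) ≡ a j)
proposition1 (suc (suc (suc (suc (suc k))))) (s≤s (s≤s (s≤s (s≤s (s≤s z≤n))))) =
  a-reflect (suc k) , a-vanish (suc k) , a-repeat (suc k)
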